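{- Let $G$ be a connected graph with diameter $D$ and $(V,\rho)$ its induced metric. Let $Q$ and $\ell\ge 2$ be positive integers, and let $\{a_1,b_1\},\dots,\{a_Q,b_Q\}$ be $Q$ pairs of vertices such that for all $1\le i\neq j\le Q$: $\overline{a_ib_i}=\overline{a_jb_j}$, the pairs $\{a_i,b_i\}$ and $\{a_j,b_j\}$ are $\alpha$-related, and $\rho(a_i,b_i)=\rho(a_j,b_j)=\ell$. Then the number of distinct lines in $(V,\rho)$ is at least $(1/2 - o(1))(Q/D)^2$, where $o(1)\to 0$ as $Q/D\to\infty$.
   Context: The metric induced by a connected graph $G$ on vertex set $V$ is $\rho(u,v)=$ length of a shortest $u$–$v$ path; the diameter is $\max\rho$. For distinct points $p,q,r$ write $[pqr]$ if $\rho(p,r)=\rho(p,q)+\rho(q,r)$; $\{p,q,r\}$ is collinear if one of $[pqr],[qrp],[rpq]$ holds. For distinct $a,b$, the line $\overline{ab}$ is $\{a,b\}$ together with all $c$ with $\{a,b,c\}$ collinear. A sequence of distinct points $(p_1,\dots,p_k)$ is geodesic if $[p_rp_sp_t]$ for all $r<s<t$; a set is geodesic if some ordering of it is a geodesic sequence. Two pairs $\{a,b\}\neq\{x,y\}$ (with $a\ne b$, $x\ne y$) are $\alpha$-related if $\overline{ab}=\overline{xy}$ and the set $\{a,b,x,y\}$ (of size $3$ or $4$) is geodesic. -}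

module Defs where

open import Data.Nat using (ℕ; zero; suc; _+_; _*_; _∸_; _≤_; _<_)
import Data.Nat as ℕ
open import Data.Bool using (Bool; _∨_)
import Data.Bool as 𝔹
open import Data.Fin using (Fin)
import Data.Fin as F
open import Data.Fin.Subset using (Subset)
open import Data.Vec using (tabulate)
open import Data.Vec.Properties using (≡-dec)
open import Data.List using (List; []; _∷_; length; filter; deduplicate; allFin; concatMap; map)
open import Data.List.Relation.Unary.Unique.Propositional using (Unique)
open import Data.List.Membership.Propositional using (_∈_)
open import Data.Product using (Σ; _×_; _,_; ∃)
open import Relation.Nullary using (¬_; ¬?)
open import Relation.Nullary.Decidable using (⌊_⌋)
open import Relation.Binary.PropositionalEquality using (_≡_; _≢_)
open import Function.Bundles using (_⇔_)

record Graph (n : ℕ) : Set₁ where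
  field
    Adj   : Fin n → Fin n → Set
    sym   : ∀ {u v} → Adj u v → Adj v u
    irrefl : ∀ {u} → ¬ Adj u u

data Walk {n : ℕ} (G : Graph n) : Fin n → Fin n → ℕ → Set where
  here : ∀ {u} → Walk G u u 0
  step : ∀ {u w v k} → Graph.Adj G u w → Walk G w v k → Walk G u v (suc k)

-- ρ is the metric induced by G: ρ u v is the length of a shortest u–v walk
-- (in particular G is connected, since every pair has a walk).
IsGraphMetric : {n : ℕ} → Graph n → (Fin n → Fin n → ℕ) → Set
IsGraphMetric G ρ =
  ∀ u v → Walk G u v (ρ u v) × (∀ k → Walk G u v k → ρ u v ≤ k)

IsDiameter : {n : ℕ} → (Fin n → Fin n → ℕ) → ℕ → Set
IsDiameter ρ D = (∀ u v → ρ u v ≤ D) × ∃ λ u → ∃ λ v → ρ u v ≡ D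

module Metric {n : ℕ} (ρ : Fin n → Fin n → ℕ) where

  Betw : Fin n → Fin n → Fin n → Set
  Betw p q r = p ≢ q × q ≢ r × p ≢ r × ρ p r ≡ ρ p q + ρ q r

  GeodesicSeq : List (Fin n) → Set
  GeodesicSeq xs = Unique xs ×
    (∀ (r s t : Fin (length xs)) → r F.< s → s F.< t →
      Betw (Data.List.lookup xs r) (Data.List.lookup xs s) (Data.List.lookup xs t))

  GeodesicSet : List (Fin n) → Set
  GeodesicSet ys = ∃ λ xs → GeodesicSeq xs × (∀ z → (z ∈ xs) ⇔ (z ∈ ys))

  betwᵇ : Fin n → Fin n → Fin n → Bool
  betwᵇ p q r = ⌊ ρ p r ℕ.≟ ρ p q + ρ q r ⌋

  -- the line through a and b, as a subset of the vertex set: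
  -- {a,b} together with all c with {a,b,c} collinear
  -- (for c ∉ {a,b} and a ≠ b the three points are distinct)
  line : Fin n → Fin n → Subset n
  line a b = tabulate λ c →
    ⌊ c F.≟ a ⌋ ∨ ⌊ c F.≟ b ⌋ ∨ betwᵇ a b c ∨ betwᵇ b c a ∨ betwᵇ c a b

  distinctPairs : List (Fin n × Fin n)
  distinctPairs =
    concatMap (λ a → map (λ b → (a , b)) (filter (λ b → ¬? (a F.≟ b)) (allFin n))) (allFin n)

  numLines : ℕ
  numLines = length (deduplicate (≡-dec 𝔹._≟_)
                       (map (λ p → line (Data.Product.proj₁ p) (Data.Product.proj₂ p)) distinctPairs))

  DistinctPairs : Fin n → Fin n → Fin n → Fin n → Set
  DistinctPairs a b x y = ¬ ((a ≡ x × b ≡ y) Data.Sum.⊎ (a ≡ y × b ≡ x))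
    where import Data.Sum

  αRelated : Fin n → Fin n → Fin n → Fin n → Set
  αRelated a b x y = a ≢ b × x ≢ y × DistinctPairs a b x y ×
    line a b ≡ line x y × GeodesicSet (a ∷ b ∷ x ∷ y ∷ [])

module Submission where

-- Fix one pair {A, B}.  Every other pair {x, y} lies on the common line, so A is either
-- outside the segment xy or strictly inside it, and A and B cannot both be inside: on a
-- geodesic ordering of {A, B, x, y} two interior points of a segment of length ℓ are less
-- than ℓ apart.  If P is outside two pairs and equidistant from their far ends f₁, f₂,
-- then ρ(f₁, f₂) = ρ(n₁, n₂) + 2ℓ for the near ends n₁, n₂: for n₁ ≠ n₂ walk along
-- geodesics from P to n₁ and on to f₁, staying on the line and beyond n₂ all the way; for
-- n₁ = n₂ read it off a geodesic ordering of the four ends.  Hence the pairs A is inside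
-- have pairwise different far distances from B, so there are at most D of them, and the
-- pairs A is outside fall into at most D classes by their far distance from A.  In a
-- largest class, of size M ≥ Q/D − 1, the far ends are distinct and no three are
-- collinear (that would contradict the triangle inequality for the near ends), so they
-- span M(M − 1)/2 lines.

open import Defs
open import Data.Nat using (ℕ; zero; suc; _+_; _*_; _∸_; _≤_; _<_; z≤n; s≤s)
import Data.Nat as ℕ
open import Data.Nat.Properties
open import Data.Nat.Tactic.RingSolver using (solve-∀)
open import Data.Fin using (Fin)
import Data.Fin as Fin
import Data.Fin.Properties as Fin
open import Data.Fin.Subset using (Subset)
open import Data.Bool using (T; _∨_)
import Data.Bool as Bool
open import Data.Bool.Properties using (T-∨)
open import Data.Vec using (lookup)
open import Data.Vec.Properties using (lookup∘tabulate; ≡-dec)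
import Data.List as List
open import Data.List using (List; []; _∷_; length; filter; map; _++_; deduplicate; allFin; applyUpTo)
open import Data.List.Membership.Propositional using (_∈_)
open import Data.List.Properties using (length-removeAt′; length-++; length-map; length-applyUpTo; length-tabulate)
open import Data.List.Membership.Propositional.Properties
  using (∈-map⁻; ∈-++⁻; ∈-applyUpTo⁺; ∈-map⁺; ∈-filter⁺; ∈-deduplicate⁺; ∈-concatMap⁺; ∈-allFin)
import Data.List.Relation.Unary.Any as Any
open import Data.List.Relation.Unary.Any.Properties using (lookup-index)
open import Data.List.Relation.Unary.Any using (here; there; index; _─_)
open import Data.List.Relation.Binary.Subset.Propositional using (_⊆_)
open import Data.List.Relation.Unary.All using (All; _∷_)
import Data.List.Relation.Unary.All as All
open import Data.List.Relation.Unary.All.Properties using (all-filter; filter⁺)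
open import Data.List.Relation.Unary.Unique.Propositional using (Unique)
import Data.List.Relation.Unary.Unique.Propositional.Properties as Unique
open import Data.List.Relation.Unary.AllPairs using ([]; _∷_)
open import Data.List.Relation.Binary.Sublist.Propositional.Properties
  using (filter-⊆; length-mono-≤) renaming (filter⁺ to filter-⊆-filter)
open import Data.Product using (_×_; _,_; ∃; proj₁; proj₂)
open import Data.Sum using (_⊎_; inj₁; inj₂)
import Data.Sum as Sum
open import Data.Empty using (⊥; ⊥-elim)
open import Function using (_∘_; case_of_)
open import Function.Bundles using (Equivalence; _⇔_; mk⇔)
open import Relation.Binary.PropositionalEquality
open import Relation.Binary.Definitions using (tri<; tri≈; tri>)
open import Relation.Nullary using (¬_; Dec; yes; no; ¬?)
open import Relation.Nullary.Decidable using (⌊_⌋; toWitness; fromWitness; _⊎-dec_; decidable-stable)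
open import Level using (0ℓ)
open import Relation.Unary using (Pred; Decidable)
open import Relation.Unary.Properties using (∁?)

module Apart where

  Apart : ℕ → ℕ → ℕ → Set
  Apart d x y = y ≡ x + d ⊎ x ≡ y + d

  apart-sym : ∀ {d x y} → Apart d x y → Apart d y x
  apart-sym = Sum.swap

  n≡n+m⇒m≡0 : ∀ n {m} → n ≡ n + m → m ≡ 0
  n≡n+m⇒m≡0 n {m} e = +-cancelˡ-≡ n m 0 (trans (sym e) (sym (+-identityʳ n)))

  apart-self : ∀ {d x} → Apart d x x → d ≡ 0
  apart-self {x = x} (inj₁ e) = n≡n+m⇒m≡0 x e
  apart-self {x = x} (inj₂ e) = n≡n+m⇒m≡0 x e

  apart-across : ∀ {d ℓ z} → Apart d z (z + ℓ + ℓ) → d ≢ 0 → d ≡ ℓ + ℓ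
  apart-across {d} {ℓ} {z} (inj₁ e) _ = +-cancelˡ-≡ z d (ℓ + ℓ) (trans (sym e) (+-assoc z ℓ ℓ))
  apart-across {d} {ℓ} {z} (inj₂ e) d≢0 =
    ⊥-elim (d≢0 (m+n≡0⇒n≡0 (ℓ + ℓ) (n≡n+m⇒m≡0 z (trans e (reassoc z ℓ d)))))
    where
    reassoc : ∀ z ℓ d → z + ℓ + ℓ + d ≡ z + (ℓ + ℓ + d)
    reassoc = solve-∀

  apart-around : ∀ {ℓ d x y z} → Apart ℓ x y → Apart ℓ x z → Apart d y z → d ≢ 0 → d ≡ ℓ + ℓ
  apart-around (inj₁ refl) (inj₁ refl) yz d≢0 = ⊥-elim (d≢0 (apart-self yz))
  apart-around (inj₁ refl) (inj₂ refl) yz d≢0 = apart-across (apart-sym yz) d≢0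
  apart-around (inj₂ refl) (inj₁ refl) yz d≢0 = apart-across yz d≢0
  apart-around {ℓ} {y = y} {z} (inj₂ refl) (inj₂ e) yz d≢0 with +-cancelʳ-≡ ℓ y z e
  ... | refl = ⊥-elim (d≢0 (apart-self yz))

  apart-between : ∀ {s t x y p} → y ≡ x + (s + t) → Apart s x p → Apart t p y → p ≡ x + s
  apart-between _ (inj₁ x+s≡p) _ = x+s≡p
  apart-between {zero} {p = p} _ (inj₂ refl) _ = sym (trans (+-identityʳ (p + 0)) (+-identityʳ p))
  apart-between {suc s} {t} {p = p} y≡ (inj₂ refl) (inj₁ y≡p+t) = ⊥-elim (
    m+1+n≰m t (≤-reflexive (trans (+-comm t _) (sym (+-cancelˡ-≡ p t _ (trans (sym y≡p+t) (trans y≡ (reassoc p s t))))))))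
    where
    reassoc : ∀ p s t → p + suc s + (suc s + t) ≡ p + (suc (s + suc s) + t)
    reassoc = solve-∀
  apart-between {suc s} {t} {p = p} y≡ (inj₂ refl) (inj₂ p≡y+t) =
    case n≡n+m⇒m≡0 p (trans p≡y+t (trans (cong (_+ t) y≡) (reassoc p s t))) of λ ()
    where
    reassoc : ∀ p s t → p + suc s + (suc s + t) + t ≡ p + suc (s + suc s + t + t)
    reassoc = solve-∀

  ¬apart-inside : ∀ {ℓ x s s′} → s < ℓ → s′ < ℓ → ¬ Apart ℓ (x + s) (x + s′)
  ¬apart-inside {ℓ} {x} {s} {s′} _ s′<ℓ (inj₁ e) =
    <⇒≱ s′<ℓ (subst (ℓ ≤_) (sym (+-cancelˡ-≡ x s′ (s + ℓ) (trans e (+-assoc x s ℓ)))) (m≤n+m ℓ s))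
  ¬apart-inside {ℓ} {x} {s} {s′} s<ℓ _ (inj₂ e) =
    <⇒≱ s<ℓ (subst (ℓ ≤_) (sym (+-cancelˡ-≡ x s (s′ + ℓ) (trans e (+-assoc x s′ ℓ)))) (m≤n+m ℓ s′))

module Counting where

  private variable
    A B : Set

  length-filter-∁ : ∀ {P : Pred A 0ℓ} (P? : Decidable P) xs →
    length (filter P? xs) + length (filter (∁? P?) xs) ≡ length xs
  length-filter-∁ P? [] = refl
  length-filter-∁ P? (x ∷ xs) with P? x
  ... | yes _ = cong suc (length-filter-∁ P? xs)
  ... | no _ = trans (+-suc _ _) (cong suc (length-filter-∁ P? xs))

  ∈-─ : ∀ {x z} {ys : List A} (x∈ys : x ∈ ys) → z ∈ ys → z ≢ x → z ∈ (ys ─ x∈ys)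
  ∈-─ (here refl) (here refl) z≢x = ⊥-elim (z≢x refl)
  ∈-─ (here _) (there z∈ys) _ = z∈ys
  ∈-─ (there _) (here z≡y) _ = here z≡y
  ∈-─ (there x∈ys) (there z∈ys) z≢x = there (∈-─ x∈ys z∈ys z≢x)

  Unique⇒length≤ : ∀ {xs ys : List A} → Unique xs → xs ⊆ ys → length xs ≤ length ys
  Unique⇒length≤ {xs = []} _ _ = z≤n
  Unique⇒length≤ {xs = x ∷ xs} {ys} (x∉xs ∷ unique) xs⊆ys = begin
    suc (length xs)          ≤⟨ s≤s (Unique⇒length≤ unique xs⊆ys─x) ⟩
    suc (length (ys ─ x∈ys)) ≡⟨ sym (length-removeAt′ ys (index x∈ys)) ⟩
    length ys                ∎
    where
    open ≤-Reasoning
    x∈ys = xs⊆ys (here refl)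
    xs⊆ys─x : xs ⊆ (ys ─ x∈ys)
    xs⊆ys─x z∈xs = ∈-─ x∈ys (xs⊆ys (there z∈xs)) (λ z≡x → All.lookup x∉xs z∈xs (sym z≡x))

  fibre : (A → ℕ) → ℕ → List A → List A
  fibre g v = filter (λ x → g x ≟ v)

  InRange : (A → ℕ) → ℕ → A → Set
  InRange g D x = 1 ≤ g x × g x ≤ D

  length≤range*fibre : (g : A → ℕ) (M D : ℕ) (xs : List A) → All (InRange g D) xs →
    (∀ v → v ≤ D → length (fibre g v xs) ≤ M) → length xs ≤ D * M
  length≤range*fibre g M zero [] _ _ = z≤n
  length≤range*fibre g M zero (x ∷ xs) ((1≤gx , gx≤0) ∷ _) _ = ⊥-elim (<⇒≱ 1≤gx gx≤0)
  length≤range*fibre g M (suc D) xs inRange fibre≤M = begin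
    length xs                                  ≡⟨ sym (length-filter-∁ (λ x → g x ≟ suc D) xs) ⟩
    length (fibre g (suc D) xs) + length rest  ≤⟨ +-mono-≤ (fibre≤M (suc D) ≤-refl) rest≤D*M ⟩
    M + D * M                                  ∎
    where
    open ≤-Reasoning
    rest = filter (∁? (λ x → g x ≟ suc D)) xs
    restInRange : All (InRange g D) rest
    restInRange = All.map (λ ((1≤gx , gx≤1+D) , gx≢1+D) → 1≤gx , ≤-pred (≤∧≢⇒< gx≤1+D gx≢1+D))
      (All.zip (filter⁺ _ inRange , all-filter _ xs))
    rest≤D*M : length rest ≤ D * M
    rest≤D*M = length≤range*fibre g M D rest restInRange λ v v≤D →
      ≤-trans (length-mono-≤ (filter-⊆-filter _ _ (λ { refl gx≡v → gx≡v }) (filter-⊆ _ xs)))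
              (fibre≤M v (m≤n⇒m≤1+n v≤D))

  argmax : (f : ℕ → ℕ) (D : ℕ) → ∃ λ v → ∀ w → w ≤ D → f w ≤ f v
  argmax f zero = 0 , λ w w≤0 → ≤-reflexive (cong f (n≤0⇒n≡0 w≤0))
  argmax f (suc D) with argmax f D
  ... | v , maximal with f (suc D) ≤? f v
  ...   | yes fD≤fv = v , λ w w≤1+D → case m≤n⇒m<n∨m≡n w≤1+D of λ
          { (inj₁ w<1+D) → maximal w (≤-pred w<1+D)
          ; (inj₂ refl) → fD≤fv }
  ...   | no fD≰fv = suc D , λ w w≤1+D → case m≤n⇒m<n∨m≡n w≤1+D of λ
          { (inj₁ w<1+D) → ≤-trans (maximal w (≤-pred w<1+D)) (≰⇒≥ fD≰fv)
          ; (inj₂ refl) → ≤-refl }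

  large-fibre : (g : A → ℕ) (D : ℕ) (xs : List A) → All (InRange g D) xs →
    ∃ λ v → length xs ≤ D * length (fibre g v xs)
  large-fibre g D xs inRange with argmax (λ v → length (fibre g v xs)) D
  ... | v , maximal = v , length≤range*fibre g _ D xs inRange maximal

  InjectiveOn : (A → B) → List A → Set
  InjectiveOn g xs = ∀ {x y} → x ∈ xs → y ∈ xs → g x ≡ g y → x ≡ y

  Unique-map⁺ : ∀ {g : A → B} {xs} → Unique xs → InjectiveOn g xs → Unique (map g xs)
  Unique-map⁺ {xs = []} _ _ = []
  Unique-map⁺ {g = g} {x ∷ xs} (x∉xs ∷ unique) injective =
    All.tabulate gx≢ ∷ Unique-map⁺ unique (λ x∈ y∈ → injective (there x∈) (there y∈))
    where
    gx≢ : ∀ {v} → v ∈ map g xs → g x ≢ v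
    gx≢ v∈ gx≡v with ∈-map⁻ g v∈
    ... | y , y∈xs , refl = All.lookup x∉xs y∈xs (injective (here refl) (there y∈xs) gx≡v)

  length≤-InjectiveOn : (g : A → ℕ) (D : ℕ) {xs : List A} → Unique xs → All (InRange g D) xs →
    InjectiveOn g xs → length xs ≤ D
  length≤-InjectiveOn g D {xs} unique inRange injective = begin
    length xs                   ≡⟨ sym (length-map g xs) ⟩
    length (map g xs)           ≤⟨ Unique⇒length≤ (Unique-map⁺ unique injective) map⊆range ⟩
    length (applyUpTo suc D)    ≡⟨ length-applyUpTo suc D ⟩
    D                           ∎
    where
    open ≤-Reasoning
    map⊆range : map g xs ⊆ applyUpTo suc D
    map⊆range v∈ with ∈-map⁻ g v∈
    ... | x , x∈xs , refl with g x | All.lookup inRange x∈xs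
    ...   | suc m | _ , 1+m≤D = ∈-applyUpTo⁺ suc 1+m≤D

module PairLines {X L : Set} (lineOf : X → X → L) (_∈ₗ_ : X → L → Set)
  (left∈ : ∀ p q → p ∈ₗ lineOf p q) (right∈ : ∀ p q → q ∈ₗ lineOf p q) where

  pairLines : List X → List L
  pairLines [] = []
  pairLines (x ∷ xs) = map (lineOf x) xs ++ pairLines xs

  2*length-pairLines : ∀ xs → 2 * length (pairLines xs) ≡ length xs * (length xs ∸ 1)
  2*length-pairLines [] = refl
  2*length-pairLines (x ∷ xs) = begin
    2 * length (map (lineOf x) xs ++ pairLines xs)  ≡⟨ cong (2 *_) (trans (length-++ (map (lineOf x) xs))
                                                          (cong (_+ _) (length-map (lineOf x) xs))) ⟩
    2 * (length xs + length (pairLines xs))         ≡⟨ add-row (length xs) (2*length-pairLines xs) ⟩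
    suc (length xs) * length xs                     ∎
    where
    open ≡-Reasoning
    add-row : ∀ s {l} → 2 * l ≡ s * (s ∸ 1) → 2 * (s + l) ≡ suc s * s
    add-row zero e = e
    add-row (suc s) {l} e = begin
      2 * (suc s + l)            ≡⟨ *-distribˡ-+ 2 (suc s) l ⟩
      2 * suc s + 2 * l          ≡⟨ cong (2 * suc s +_) e ⟩
      2 * suc s + suc s * s      ≡⟨ identity s ⟩
      suc (suc s) * suc s        ∎
      where
      identity : ∀ s → 2 * suc s + suc s * s ≡ suc (suc s) * suc s
      identity = solve-∀

  pairLines⁻ : ∀ {xs l} → Unique xs → l ∈ pairLines xs →
    ∃ λ p → ∃ λ q → p ∈ xs × q ∈ xs × p ≢ q × l ≡ lineOf p q
  pairLines⁻ {x ∷ xs} (x∉xs ∷ unique) l∈ with ∈-++⁻ (map (lineOf x) xs) l∈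
  ... | inj₁ l∈map with ∈-map⁻ (lineOf x) l∈map
  ...   | q , q∈xs , refl = x , q , here refl , there q∈xs , All.lookup x∉xs q∈xs , refl
  pairLines⁻ {x ∷ xs} (_ ∷ unique) _ | inj₂ l∈rest with pairLines⁻ unique l∈rest
  ...   | p , q , p∈xs , q∈xs , p≢q , refl = p , q , there p∈xs , there q∈xs , p≢q , refl

  GeneralPosition : List X → Set
  GeneralPosition xs = ∀ {p q z} → p ∈ xs → q ∈ xs → z ∈ xs → p ≢ q → z ≢ p → z ≢ q → ¬ z ∈ₗ lineOf p q

  GeneralPosition-⊆ : ∀ {xs ys} → ys ⊆ xs → GeneralPosition xs → GeneralPosition ys
  GeneralPosition-⊆ ys⊆xs gp p∈ q∈ z∈ = gp (ys⊆xs p∈) (ys⊆xs q∈) (ys⊆xs z∈)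

  Unique-map-lineOf : ∀ x ys → Unique (x ∷ ys) → GeneralPosition (x ∷ ys) → Unique (map (lineOf x) ys)
  Unique-map-lineOf x [] _ _ = []
  Unique-map-lineOf x (y ∷ ys) ((x≢y ∷ x∉ys) ∷ y∉ys ∷ unique) gp =
    All.tabulate lineOf-x-y≢ ∷ Unique-map-lineOf x ys (x∉ys ∷ unique) (GeneralPosition-⊆ drop-y gp)
    where
    drop-y : (x ∷ ys) ⊆ (x ∷ y ∷ ys)
    drop-y (here z≡x) = here z≡x
    drop-y (there z∈ys) = there (there z∈ys)
    lineOf-x-y≢ : ∀ {l} → l ∈ map (lineOf x) ys → lineOf x y ≢ l
    lineOf-x-y≢ l∈ e with ∈-map⁻ (lineOf x) l∈
    ... | z , z∈ys , refl = gp (here refl) (there (here refl)) (there (there z∈ys)) x≢y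
      (λ z≡x → All.lookup x∉ys z∈ys (sym z≡x)) (λ z≡y → All.lookup y∉ys z∈ys (sym z≡y))
      (subst (z ∈ₗ_) (sym e) (right∈ x z))

  Unique-pairLines : ∀ {xs} → Unique xs → GeneralPosition xs → Unique (pairLines xs)
  Unique-pairLines {[]} _ _ = []
  Unique-pairLines {x ∷ xs} (x∉xs ∷ unique) gp =
    Unique.++⁺ (Unique-map-lineOf x xs (x∉xs ∷ unique) gp)
               (Unique-pairLines unique (GeneralPosition-⊆ there gp)) disjoint
    where
    disjoint : ∀ {l} → ¬ (l ∈ map (lineOf x) xs × l ∈ pairLines xs)
    disjoint (l∈map , l∈rest) with ∈-map⁻ (lineOf x) l∈map | pairLines⁻ unique l∈rest
    ... | q , _ , refl | p , q′ , p∈xs , q′∈xs , p≢q′ , e =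
      gp (there p∈xs) (there q′∈xs) (here refl) p≢q′
        (λ x≡p → All.lookup x∉xs p∈xs x≡p) (λ x≡q′ → All.lookup x∉xs q′∈xs x≡q′)
        (subst (x ∈ₗ_) e (left∈ x q))

module Collinearity {n : ℕ} (ρ : Fin n → Fin n → ℕ) where
  open Metric ρ using (line; betwᵇ; distinctPairs; numLines)

  -- The paper's [p q r], without its distinctness condition.
  Between : Fin n → Fin n → Fin n → Set
  Between p q r = ρ p r ≡ ρ p q + ρ q r

  data Collinear (x y c : Fin n) : Set where
    at-x  : c ≡ x → Collinear x y c
    at-y  : c ≡ y → Collinear x y c
    x-y-c : Between x y c → Collinear x y c
    y-c-x : Between y c x → Collinear x y c
    c-x-y : Between c x y → Collinear x y c

  _∈ₗ_ : Fin n → Subset n → Set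
  c ∈ₗ S = T (lookup S c)

  Collinear⇔∈line : ∀ {x y c} → Collinear x y c ⇔ c ∈ₗ line x y
  Collinear⇔∈line {x} {y} {c} =
    mk⇔ (subst T (sym (lookup∘tabulate _ c)) ∘ encode) (decode ∘ subst T (lookup∘tabulate _ c))
    where
    isX = ⌊ c Fin.≟ x ⌋
    isY = ⌊ c Fin.≟ y ⌋
    xyc = betwᵇ x y c
    ycx = betwᵇ y c x
    cxy = betwᵇ c x y
    ∨⁺ˡ : ∀ a b → T a → T (a ∨ b)
    ∨⁺ˡ _ _ = Equivalence.from T-∨ ∘ inj₁
    ∨⁺ʳ : ∀ a b → T b → T (a ∨ b)
    ∨⁺ʳ _ _ = Equivalence.from T-∨ ∘ inj₂
    ∨⁻ : ∀ a b → T (a ∨ b) → T a ⊎ T b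
    ∨⁻ _ _ = Equivalence.to T-∨
    encode : Collinear x y c → T (isX ∨ isY ∨ xyc ∨ ycx ∨ cxy)
    encode (at-x e)  = ∨⁺ˡ isX _ (fromWitness e)
    encode (at-y e)  = ∨⁺ʳ isX _ (∨⁺ˡ isY _ (fromWitness e))
    encode (x-y-c b) = ∨⁺ʳ isX _ (∨⁺ʳ isY _ (∨⁺ˡ xyc _ (fromWitness b)))
    encode (y-c-x b) = ∨⁺ʳ isX _ (∨⁺ʳ isY _ (∨⁺ʳ xyc _ (∨⁺ˡ ycx _ (fromWitness b))))
    encode (c-x-y b) = ∨⁺ʳ isX _ (∨⁺ʳ isY _ (∨⁺ʳ xyc _ (∨⁺ʳ ycx cxy (fromWitness b))))
    decode : T (isX ∨ isY ∨ xyc ∨ ycx ∨ cxy) → Collinear x y c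
    decode t with ∨⁻ isX _ t
    ... | inj₁ t = at-x (toWitness t)
    ... | inj₂ t with ∨⁻ isY _ t
    ...   | inj₁ t = at-y (toWitness t)
    ...   | inj₂ t with ∨⁻ xyc _ t
    ...     | inj₁ t = x-y-c (toWitness t)
    ...     | inj₂ t with ∨⁻ ycx cxy t
    ...       | inj₁ t = y-c-x (toWitness t)
    ...       | inj₂ t = c-x-y (toWitness t)

  line-≡⇒Collinear : ∀ {x y x′ y′ c} → line x y ≡ line x′ y′ → Collinear x y c → Collinear x′ y′ c
  line-≡⇒Collinear {c = c} e = Equivalence.from Collinear⇔∈line ∘ subst (c ∈ₗ_) e ∘ Equivalence.to Collinear⇔∈line

  open PairLines line _∈ₗ_ (λ _ _ → Equivalence.to Collinear⇔∈line (at-x refl))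
      (λ _ _ → Equivalence.to Collinear⇔∈line (at-y refl)) public

  ∈distinctPairs : ∀ {p q} → p ≢ q → (p , q) ∈ distinctPairs
  ∈distinctPairs {p} {q} p≢q = ∈-concatMap⁺ _ (Any.map (λ { refl → pq∈ }) (∈-allFin p))
    where
    pq∈ : (p , q) ∈ map (p ,_) (filter (λ b → ¬? (p Fin.≟ b)) (allFin n))
    pq∈ = ∈-map⁺ (p ,_) (∈-filter⁺ (λ b → ¬? (p Fin.≟ b)) (∈-allFin q) p≢q)

  numLines-≥ : ∀ {ps} → Unique ps → GeneralPosition ps → length ps * (length ps ∸ 1) ≤ 2 * numLines
  numLines-≥ {ps} unique gp = begin
    length ps * (length ps ∸ 1)    ≡⟨ sym (2*length-pairLines ps) ⟩
    2 * length (pairLines ps)      ≤⟨ *-monoʳ-≤ 2 (Unique⇒length≤ (Unique-pairLines unique gp) pairLines⊆lines) ⟩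
    2 * numLines                   ∎
    where
    open ≤-Reasoning
    open Counting using (Unique⇒length≤)
    pairLines⊆lines : pairLines ps ⊆ deduplicate (≡-dec Bool._≟_) (map (λ (p , q) → line p q) distinctPairs)
    pairLines⊆lines l∈ with pairLines⁻ unique l∈
    ... | p , q , _ , _ , p≢q , refl = ∈-deduplicate⁺ (≡-dec Bool._≟_) (∈-map⁺ _ (∈distinctPairs p≢q))

module GraphMetric {n : ℕ} (G : Graph n) (ρ : Fin n → Fin n → ℕ) (isMetric : IsGraphMetric G ρ) where
  open Graph G using (Adj) renaming (sym to Adj-sym)
  open Collinearity ρ
  open Apart
  open Metric ρ using (GeodesicSeq; GeodesicSet)

  _++ʷ_ : ∀ {u w v k k′} → Walk G u w k → Walk G w v k′ → Walk G u v (k + k′)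
  here ++ʷ q = q
  step u~w p ++ʷ q = step u~w (p ++ʷ q)

  reverseʷ : ∀ {u v k} → Walk G u v k → Walk G v u k
  reverseʷ here = here
  reverseʷ {k = suc k} (step u~w p) =
    subst (Walk G _ _) (+-comm k 1) (reverseʷ p ++ʷ step (Adj-sym u~w) here)

  shortest : ∀ u v → Walk G u v (ρ u v)
  shortest u v = proj₁ (isMetric u v)

  ρ-≤-walk : ∀ {u v k} → Walk G u v k → ρ u v ≤ k
  ρ-≤-walk {u} {v} {k} = proj₂ (isMetric u v) k

  ρ-sym : ∀ u v → ρ u v ≡ ρ v u
  ρ-sym u v = ≤-antisym (ρ-≤-walk (reverseʷ (shortest v u))) (ρ-≤-walk (reverseʷ (shortest u v)))

  ρ-triangle : ∀ u w v → ρ u v ≤ ρ u w + ρ w v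
  ρ-triangle u w v = ρ-≤-walk (shortest u w ++ʷ shortest w v)

  ρ-refl : ∀ u → ρ u u ≡ 0
  ρ-refl u = n≤0⇒n≡0 (ρ-≤-walk (here {u = u}))

  ρ≡0⇒≡ : ∀ {u v} → ρ u v ≡ 0 → u ≡ v
  ρ≡0⇒≡ {u} {v} ρ≡0 with subst (Walk G u v) ρ≡0 (shortest u v)
  ... | here = refl

  ≢⇒1≤ρ : ∀ {u v} → u ≢ v → 1 ≤ ρ u v
  ≢⇒1≤ρ u≢v = n≢0⇒n>0 (u≢v ∘ ρ≡0⇒≡)

  Adj⇒ρ≤1 : ∀ {u v} → Adj u v → ρ u v ≤ 1
  Adj⇒ρ≤1 u~v = ρ-≤-walk (step u~v here)

  Between-rev : ∀ {p q r} → Between p q r → Between r q p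
  Between-rev {p} {q} {r} pqr = begin
    ρ r p          ≡⟨ ρ-sym r p ⟩
    ρ p r          ≡⟨ pqr ⟩
    ρ p q + ρ q r  ≡⟨ +-comm (ρ p q) (ρ q r) ⟩
    ρ q r + ρ p q  ≡⟨ cong₂ _+_ (ρ-sym q r) (ρ-sym p q) ⟩
    ρ r q + ρ q p  ∎
    where open ≡-Reasoning

  Between-narrow : ∀ {p w q r} → Between p w q → Between p q r → Between w q r
  Between-narrow {p} {w} {q} {r} pwq pqr = ≤-antisym (ρ-triangle w q r) (+-cancelˡ-≤ (ρ p w) _ _ (begin
    ρ p w + (ρ w q + ρ q r)  ≡⟨ sym (+-assoc (ρ p w) (ρ w q) (ρ q r)) ⟩
    ρ p w + ρ w q + ρ q r    ≡⟨ cong (_+ ρ q r) (sym pwq) ⟩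
    ρ p q + ρ q r            ≡⟨ sym pqr ⟩
    ρ p r                    ≤⟨ ρ-triangle p w r ⟩
    ρ p w + ρ w r            ∎))
    where open ≤-Reasoning

  Collinear-sym : ∀ {x y c} → Collinear x y c → Collinear y x c
  Collinear-sym (at-x e)  = at-y e
  Collinear-sym (at-y e)  = at-x e
  Collinear-sym (x-y-c b) = c-x-y (Between-rev b)
  Collinear-sym (y-c-x b) = y-c-x (Between-rev b)
  Collinear-sym (c-x-y b) = x-y-c (Between-rev b)

  geodesic-induction : ∀ {s t} (P : Fin n → Set) →
    (∀ {w w′} → Adj w w′ → Between s w t → Between s w′ t → P w → P w′) → P s → P t
  geodesic-induction {s} {t} P closed Ps = along (shortest s t) (cong (_+ ρ s t) (ρ-refl s)) Ps
    where
    on-geodesic : ∀ {w k} → Walk G w t k → ρ s w + k ≡ ρ s t → Between s w t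
    on-geodesic {w} p tight =
      ≤-antisym (ρ-triangle s w t) (≤-trans (+-monoʳ-≤ (ρ s w) (ρ-≤-walk p)) (≤-reflexive tight))
    along : ∀ {w k} → Walk G w t k → ρ s w + k ≡ ρ s t → P w → P t
    along here _ Pt = Pt
    along {w} {suc k} (step {w = w′} w~w′ p) tight Pw =
      along p tight′ (closed w~w′ (on-geodesic (step w~w′ p) tight) (on-geodesic p tight′) Pw)
      where
      open ≤-Reasoning
      tight′ : ρ s w′ + k ≡ ρ s t
      tight′ = ≤-antisym (begin
        ρ s w′ + k           ≤⟨ +-monoˡ-≤ k (ρ-triangle s w w′) ⟩
        ρ s w + ρ w w′ + k   ≤⟨ +-monoˡ-≤ k (+-monoʳ-≤ (ρ s w) (Adj⇒ρ≤1 w~w′)) ⟩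
        ρ s w + 1 + k        ≡⟨ trans (+-assoc (ρ s w) 1 k) (+-suc (ρ s w) k) ⟩
        suc (ρ s w + k)      ≡⟨ sym (+-suc (ρ s w) k) ⟩
        ρ s w + suc k        ≡⟨ tight ⟩
        ρ s t                ∎) (≤-trans (ρ-triangle s w′ t) (+-monoʳ-≤ (ρ s w′) (ρ-≤-walk p)))

  ρ+m≤m⇒≡ : ∀ {u v} m → ρ u v + m ≤ m → u ≡ v
  ρ+m≤m⇒≡ {u} {v} m le = ρ≡0⇒≡ (n≤0⇒n≡0 (+-cancelʳ-≤ m (ρ u v) 0 le))

  -- w lies beyond x and w′ beyond y, which are at least 2 apart: one edge cannot bridge that.
  ¬Between-jump : ∀ {x y w w′} → 2 ≤ ρ x y → Adj w w′ → Between w x y → ¬ Between x y w′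
  ¬Between-jump {x} {y} {w} {w′} 2≤d w~w′ wxy xyw′ =
    <⇒≱ (≤-trans (m≤m+n 3 1) (+-mono-≤ 2≤d 2≤d)) (+-cancelˡ-≤ (ρ w x + ρ y w′) (d + d) 2 (begin
      (ρ w x + ρ y w′) + (d + d)        ≡⟨ regroup (ρ w x) (ρ y w′) d ⟩
      (ρ w x + d) + (d + ρ y w′)        ≡⟨ cong₂ _+_ (sym wxy) (sym xyw′) ⟩
      ρ w y + ρ x w′                    ≤⟨ +-mono-≤ (ρ-triangle w w′ y) (ρ-triangle x w w′) ⟩
      (ρ w w′ + ρ w′ y) + (ρ x w + ρ w w′)
        ≤⟨ +-mono-≤ (+-mono-≤ (Adj⇒ρ≤1 w~w′) (≤-reflexive (ρ-sym w′ y)))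
                    (+-mono-≤ (≤-reflexive (ρ-sym x w)) (Adj⇒ρ≤1 w~w′)) ⟩
      (1 + ρ y w′) + (ρ w x + 1)        ≡⟨ regroup′ (ρ w x) (ρ y w′) ⟩
      (ρ w x + ρ y w′) + 2              ∎))
    where
    open ≤-Reasoning
    d = ρ x y
    regroup : ∀ a b d → (a + b) + (d + d) ≡ (a + d) + (d + b)
    regroup = solve-∀
    regroup′ : ∀ a b → (1 + b) + (a + 1) ≡ (a + b) + 2
    regroup′ = solve-∀

  Between-step : ∀ {x y w w′} → 2 ≤ ρ x y → Adj w w′ → Between w x y →
    Collinear x y w′ → ¬ Between x w′ y → Between w′ x y
  Between-step {x} {y} _ _ _ (at-x refl) _ = sym (cong (_+ ρ x y) (ρ-refl x))
  Between-step {x} {y} _ _ _ (at-y refl) ¬xw′y =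
    ⊥-elim (¬xw′y (sym (trans (cong (ρ x y +_) (ρ-refl y)) (+-identityʳ (ρ x y)))))
  Between-step 2≤d w~w′ wxy (x-y-c xyw′) _ = ⊥-elim (¬Between-jump 2≤d w~w′ wxy xyw′)
  Between-step _ _ _ (y-c-x yw′x) ¬xw′y = ⊥-elim (¬xw′y (Between-rev yw′x))
  Between-step _ _ _ (c-x-y w′xy) _ = w′xy

  -- Along geodesics P → n₁ → f₁ every point is on the common line and never inside n₂f₂
  -- (that would force n₁ = n₂), so by Between-step it stays beyond n₂ all the way.
  module TwoSegments {P n₁ f₁ n₂ f₂ : Fin n} {ℓ : ℕ} (2≤ℓ : 2 ≤ ℓ)
    (ρ₁ : ρ n₁ f₁ ≡ ℓ) (ρ₂ : ρ n₂ f₂ ≡ ℓ)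
    (beyond₁ : Between P n₁ f₁) (beyond₂ : Between P n₂ f₂) (equidistant : ρ P f₁ ≡ ρ P f₂)
    (sameLine : ∀ {c} → Collinear n₁ f₁ c → Collinear n₂ f₂ c) (n₁≢n₂ : n₁ ≢ n₂) where

    open ≤-Reasoning

    2≤ρ₂ : 2 ≤ ρ n₂ f₂
    2≤ρ₂ = subst (2 ≤_) (sym ρ₂) 2≤ℓ

    ¬between-before : ∀ {w} → Between P w n₁ → ¬ Between n₂ w f₂
    ¬between-before {w} Pwn₁ n₂wf₂ = n₁≢n₂ (ρ+m≤m⇒≡ (ρ w f₂) (begin
      ρ n₁ n₂ + ρ w f₂            ≤⟨ +-monoˡ-≤ (ρ w f₂) (≤-trans (ρ-triangle n₁ w n₂) (≤-reflexive
                                       (cong₂ _+_ (ρ-sym n₁ w) (ρ-sym w n₂)))) ⟩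
      ρ w n₁ + ρ n₂ w + ρ w f₂    ≡⟨ trans (+-assoc (ρ w n₁) _ _) (cong (ρ w n₁ +_) (trans (sym n₂wf₂) ρ₂)) ⟩
      ρ w n₁ + ℓ                  ≤⟨ +-cancelˡ-≤ (ρ P w) _ _ (begin
        ρ P w + (ρ w n₁ + ℓ)        ≡⟨ sym (+-assoc (ρ P w) (ρ w n₁) ℓ) ⟩
        ρ P w + ρ w n₁ + ℓ          ≡⟨ cong₂ _+_ (sym Pwn₁) (sym ρ₁) ⟩
        ρ P n₁ + ρ n₁ f₁            ≡⟨ sym beyond₁ ⟩
        ρ P f₁                      ≡⟨ equidistant ⟩
        ρ P f₂                      ≤⟨ ρ-triangle P w f₂ ⟩
        ρ P w + ρ w f₂              ∎) ⟩
      ρ w f₂                      ∎))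

    n₁-beyond-n₂ : Between n₁ n₂ f₂
    n₁-beyond-n₂ = geodesic-induction (λ w → Between w n₂ f₂)
      (λ w~w′ _ Pw′n₁ wn₂f₂ → Between-step 2≤ρ₂ w~w′ wn₂f₂
        (sameLine (c-x-y (Between-narrow Pw′n₁ beyond₁))) (¬between-before Pw′n₁))
      beyond₂

    ¬between-inside : ∀ {w} → Between n₁ w f₁ → ¬ Between n₂ w f₂
    ¬between-inside {w} n₁wf₁ n₂wf₂ = n₁≢n₂ (ρ+m≤m⇒≡ ℓ (begin
      ρ n₁ n₂ + ℓ       ≡⟨ cong (ρ n₁ n₂ +_) (sym ρ₂) ⟩
      ρ n₁ n₂ + ρ n₂ f₂ ≡⟨ sym n₁-beyond-n₂ ⟩
      ρ n₁ f₂           ≤⟨ ρ-triangle n₁ w f₂ ⟩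
      ρ n₁ w + ρ w f₂   ≤⟨ +-monoˡ-≤ (ρ w f₂) n₁w≤n₂w ⟩
      ρ n₂ w + ρ w f₂   ≡⟨ trans (sym n₂wf₂) ρ₂ ⟩
      ℓ                 ∎))
      where
      n₁w≤n₂w : ρ n₁ w ≤ ρ n₂ w
      n₁w≤n₂w = +-cancelʳ-≤ (ρ w f₁) _ _ (begin
        ρ n₁ w + ρ w f₁   ≡⟨ trans (sym n₁wf₁) ρ₁ ⟩
        ℓ                 ≤⟨ +-cancelˡ-≤ (ρ P n₁) _ _ (begin
          ρ P n₁ + ℓ                   ≡⟨ cong (ρ P n₁ +_) (sym ρ₁) ⟩
          ρ P n₁ + ρ n₁ f₁             ≡⟨ sym beyond₁ ⟩
          ρ P f₁                       ≤⟨ ρ-triangle P w f₁ ⟩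
          ρ P w + ρ w f₁               ≤⟨ +-monoˡ-≤ (ρ w f₁) (ρ-triangle P n₂ w) ⟩
          ρ P n₂ + ρ n₂ w + ρ w f₁     ≡⟨ cong (λ d → d + ρ n₂ w + ρ w f₁) (sym near-equidistant) ⟩
          ρ P n₁ + ρ n₂ w + ρ w f₁     ≡⟨ +-assoc (ρ P n₁) _ _ ⟩
          ρ P n₁ + (ρ n₂ w + ρ w f₁)   ∎) ⟩
        ρ n₂ w + ρ w f₁   ∎)
        where
        near-equidistant : ρ P n₁ ≡ ρ P n₂
        near-equidistant = +-cancelʳ-≡ ℓ _ _ (begin-equality
          ρ P n₁ + ℓ       ≡⟨ cong (ρ P n₁ +_) (sym ρ₁) ⟩
          ρ P n₁ + ρ n₁ f₁ ≡⟨ sym beyond₁ ⟩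
          ρ P f₁           ≡⟨ equidistant ⟩
          ρ P f₂           ≡⟨ beyond₂ ⟩
          ρ P n₂ + ρ n₂ f₂ ≡⟨ cong (ρ P n₂ +_) ρ₂ ⟩
          ρ P n₂ + ℓ       ∎)

    f₁-beyond-n₂ : Between f₁ n₂ f₂
    f₁-beyond-n₂ = geodesic-induction (λ w → Between w n₂ f₂)
      (λ w~w′ _ n₁w′f₁ wn₂f₂ → Between-step 2≤ρ₂ w~w′ wn₂f₂
        (sameLine (y-c-x (Between-rev n₁w′f₁))) (¬between-inside n₁w′f₁))
      n₁-beyond-n₂

  far-ends-apart-distinct : ∀ {P n₁ f₁ n₂ f₂ ℓ} → 2 ≤ ℓ → ρ n₁ f₁ ≡ ℓ → ρ n₂ f₂ ≡ ℓ →
    Between P n₁ f₁ → Between P n₂ f₂ → ρ P f₁ ≡ ρ P f₂ →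
    (∀ {c} → Collinear n₁ f₁ c → Collinear n₂ f₂ c) → (∀ {c} → Collinear n₂ f₂ c → Collinear n₁ f₁ c) →
    n₁ ≢ n₂ → ρ f₁ f₂ ≡ ρ n₁ n₂ + ℓ + ℓ
  far-ends-apart-distinct {P} {n₁} {f₁} {n₂} {f₂} {ℓ}
    2≤ℓ ρ₁ ρ₂ beyond₁ beyond₂ equidistant line₁⊆line₂ line₂⊆line₁ n₁≢n₂ =
    begin
      ρ f₁ f₂                ≡⟨ f₁-beyond-n₂ ⟩
      ρ f₁ n₂ + ρ n₂ f₂      ≡⟨ cong₂ _+_ (ρ-sym f₁ n₂) ρ₂ ⟩
      ρ n₂ f₁ + ℓ            ≡⟨ cong (_+ ℓ) n₂-beyond-n₁ ⟩
      ρ n₂ n₁ + ρ n₁ f₁ + ℓ  ≡⟨ cong₂ (λ d e → d + e + ℓ) (ρ-sym n₂ n₁) ρ₁ ⟩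
      ρ n₁ n₂ + ℓ + ℓ        ∎
    where
    open ≡-Reasoning
    open TwoSegments 2≤ℓ ρ₁ ρ₂ beyond₁ beyond₂ equidistant line₁⊆line₂ n₁≢n₂ using (f₁-beyond-n₂)
    open TwoSegments 2≤ℓ ρ₂ ρ₁ beyond₂ beyond₁ (sym equidistant) line₂⊆line₁ (n₁≢n₂ ∘ sym)
      using () renaming (n₁-beyond-n₂ to n₂-beyond-n₁)

  IsRuler : (Fin n → ℕ) → List (Fin n) → Set
  IsRuler c S = ∀ {p q} → p ∈ S → q ∈ S → Apart (ρ p q) (c p) (c q)

  GeodesicSeq⇒IsRuler : ∀ {x₀ xs} → GeodesicSeq (x₀ ∷ xs) → IsRuler (ρ x₀) (x₀ ∷ xs)
  GeodesicSeq⇒IsRuler {x₀} {xs} (_ , geodesic) p∈ q∈ =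
    subst₂ (λ p q → Apart (ρ p q) (ρ x₀ p) (ρ x₀ q)) (sym (lookup-index p∈)) (sym (lookup-index q∈))
      (at-indices (index p∈) (index q∈))
    where
    at : Fin (length (x₀ ∷ xs)) → Fin n
    at = List.lookup (x₀ ∷ xs)
    ordered : ∀ i j → i Fin.< j → ρ x₀ (at j) ≡ ρ x₀ (at i) + ρ (at i) (at j)
    ordered Fin.zero j _ = cong (_+ ρ x₀ (at j)) (sym (ρ-refl x₀))
    ordered (Fin.suc i) j i<j with geodesic Fin.zero (Fin.suc i) j (s≤s z≤n) i<j
    ... | _ , _ , _ , x₀ij = x₀ij
    at-indices : ∀ i j → Apart (ρ (at i) (at j)) (ρ x₀ (at i)) (ρ x₀ (at j))
    at-indices i j with Fin.<-cmp i j
    ... | tri< i<j _ _ = inj₁ (ordered i j i<j)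
    ... | tri≈ _ refl _ = inj₁ (sym (trans (cong (ρ x₀ (at i) +_) (ρ-refl (at i))) (+-identityʳ _)))
    ... | tri> _ _ j<i = inj₂ (trans (ordered j i j<i) (cong (ρ x₀ (at j) +_) (ρ-sym (at j) (at i))))

  GeodesicSet⇒IsRuler : ∀ {S} → GeodesicSet S → ∃ λ c → IsRuler c S
  GeodesicSet⇒IsRuler ([] , _ , same) = (λ _ → 0) , λ p∈ → case Equivalence.from (same _) p∈ of λ ()
  GeodesicSet⇒IsRuler ((x₀ ∷ xs) , geodesic , same) =
    ρ x₀ , λ p∈ q∈ → GeodesicSeq⇒IsRuler geodesic (Equivalence.from (same _) p∈) (Equivalence.from (same _) q∈)

  far-ends-apart-common : ∀ {c S x f₁ f₂ ℓ} → IsRuler c S → x ∈ S → f₁ ∈ S → f₂ ∈ S →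
    ρ x f₁ ≡ ℓ → ρ x f₂ ≡ ℓ → f₁ ≢ f₂ → ρ f₁ f₂ ≡ ℓ + ℓ
  far-ends-apart-common ruler x∈ f₁∈ f₂∈ ρ₁ ρ₂ f₁≢f₂ =
    apart-around (subst (λ d → Apart d _ _) ρ₁ (ruler x∈ f₁∈)) (subst (λ d → Apart d _ _) ρ₂ (ruler x∈ f₂∈))
      (ruler f₁∈ f₂∈) (f₁≢f₂ ∘ ρ≡0⇒≡)

  Outside : Fin n → Fin n → Fin n → Set
  Outside P x y = Apart (ρ x y) (ρ P x) (ρ P y)

  Inside : Fin n → Fin n → Fin n → Set
  Inside P x y = Between x P y × P ≢ x × P ≢ y

  Inside-sym : ∀ {P x y} → Inside P x y → Inside P y x
  Inside-sym (xPy , P≢x , P≢y) = Between-rev xPy , P≢y , P≢x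

  Inside⇒< : ∀ {P x y} → Inside P x y → ρ x P < ρ x y
  Inside⇒< {P} {x} {y} (xPy , _ , P≢y) = subst (ρ x P <_) (sym xPy) (m<m+n (ρ x P) (≢⇒1≤ρ P≢y))

  ¬Outside⇒Inside : ∀ {P x y} → Collinear x y P → ¬ Outside P x y → Inside P x y
  ¬Outside⇒Inside {P} {x} {y} collinear ¬outside = between collinear , P≢x , P≢y
    where
    P≢x : P ≢ x
    P≢x refl = ¬outside (inj₁ (cong (_+ ρ x y) (sym (ρ-refl x))))
    P≢y : P ≢ y
    P≢y refl = ¬outside (inj₂ (trans (ρ-sym y x) (cong (_+ ρ x y) (sym (ρ-refl y)))))
    between : Collinear x y P → Between x P y
    between (at-x P≡x) = ⊥-elim (P≢x P≡x)
    between (at-y P≡y) = ⊥-elim (P≢y P≡y)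
    between (x-y-c xyP) = ⊥-elim (¬outside (inj₂ (begin
      ρ P x          ≡⟨ Between-rev xyP ⟩
      ρ P y + ρ y x  ≡⟨ cong (ρ P y +_) (ρ-sym y x) ⟩
      ρ P y + ρ x y  ∎)))
      where open ≡-Reasoning
    between (y-c-x yPx) = Between-rev yPx
    between (c-x-y Pxy) = ⊥-elim (¬outside (inj₁ Pxy))

  ¬Inside×Inside : ∀ {c S A B x y} → IsRuler c S → A ∈ S → B ∈ S → x ∈ S → y ∈ S →
    ρ A B ≡ ρ x y → Inside A x y → Inside B x y → ⊥
  ¬Inside×Inside {c} {S} {A} {B} {x} {y} ruler A∈ B∈ x∈ y∈ ρAB inA inB = case ruler x∈ y∈ of λ
    { (inj₁ cy) → from-end x∈ y∈ cy ρAB inA inB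
    ; (inj₂ cx) → from-end y∈ x∈ (trans cx (cong (c y +_) (ρ-sym x y))) (trans ρAB (ρ-sym x y))
                    (Inside-sym inA) (Inside-sym inB) }
    where
    from-end : ∀ {x y} → x ∈ S → y ∈ S → c y ≡ c x + ρ x y → ρ A B ≡ ρ x y →
      Inside A x y → Inside B x y → ⊥
    from-end {x} {y} x∈ y∈ cy ρAB inA inB =
      ¬apart-inside (Inside⇒< inA) (Inside⇒< inB)
        (subst₂ (Apart (ρ x y)) (coordinate A∈ inA) (coordinate B∈ inB) (subst (λ d → Apart d _ _) ρAB (ruler A∈ B∈)))
      where
      coordinate : ∀ {P} → P ∈ S → Inside P x y → c P ≡ c x + ρ x P
      coordinate P∈ (xPy , _) = apart-between (trans cy (cong (c x +_) xPy)) (ruler x∈ P∈) (ruler P∈ y∈)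

  ¬Between-far-ends : ∀ {n₁ f₁ n₂ f₂ n₃ f₃ ℓ} → 1 ≤ ℓ →
    ρ f₁ f₂ ≡ ρ n₁ n₂ + ℓ + ℓ → ρ f₂ f₃ ≡ ρ n₂ n₃ + ℓ + ℓ → ρ f₁ f₃ ≡ ρ n₁ n₃ + ℓ + ℓ →
    ¬ Between f₁ f₂ f₃
  ¬Between-far-ends {n₁} {f₁} {n₂} {f₂} {n₃} {f₃} {ℓ} 1≤ℓ ρ₁₂ ρ₂₃ ρ₁₃ f₁f₂f₃ =
    <⇒≱ (m<m+n 0 (+-mono-≤ 1≤ℓ z≤n)) (+-cancelˡ-≤ (ρ n₁ n₃ + ℓ + ℓ) (ℓ + ℓ) 0 (begin
      ρ n₁ n₃ + ℓ + ℓ + (ℓ + ℓ)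
        ≤⟨ +-monoˡ-≤ (ℓ + ℓ) (+-monoˡ-≤ ℓ (+-monoˡ-≤ ℓ (ρ-triangle n₁ n₂ n₃))) ⟩
      ρ n₁ n₂ + ρ n₂ n₃ + ℓ + ℓ + (ℓ + ℓ)          ≡⟨ regroup (ρ n₁ n₂) (ρ n₂ n₃) ℓ ⟩
      (ρ n₁ n₂ + ℓ + ℓ) + (ρ n₂ n₃ + ℓ + ℓ)        ≡⟨ cong₂ _+_ (sym ρ₁₂) (sym ρ₂₃) ⟩
      ρ f₁ f₂ + ρ f₂ f₃                            ≡⟨ sym f₁f₂f₃ ⟩
      ρ f₁ f₃                                      ≡⟨ ρ₁₃ ⟩
      ρ n₁ n₃ + ℓ + ℓ                              ≡⟨ sym (+-identityʳ _) ⟩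
      ρ n₁ n₃ + ℓ + ℓ + 0                          ∎))
    where
    open ≤-Reasoning
    regroup : ∀ d e ℓ → d + e + ℓ + ℓ + (ℓ + ℓ) ≡ (d + ℓ + ℓ) + (e + ℓ + ℓ)
    regroup = solve-∀

  orient : Fin n → Fin n → Fin n → Fin n × Fin n
  orient P x y with ρ P x ≤? ρ P y
  ... | yes _ = x , y
  ... | no _ = y , x

  SameEnds : Fin n × Fin n → Fin n → Fin n → Set
  SameEnds (p , q) x y = (p ≡ x × q ≡ y) ⊎ (p ≡ y × q ≡ x)

  orient-ends : ∀ P x y → SameEnds (orient P x y) x y
  orient-ends P x y with ρ P x ≤? ρ P y
  ... | yes _ = inj₁ (refl , refl)
  ... | no _ = inj₂ (refl , refl)

  orient-beyond : ∀ {P x y} → 0 < ρ x y → Outside P x y →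
    Between P (proj₁ (orient P x y)) (proj₂ (orient P x y))
  orient-beyond {P} {x} {y} 0<d outside with ρ P x ≤? ρ P y | outside
  ... | yes _ | inj₁ Pxy = Pxy
  ... | yes Px≤Py | inj₂ Px≡ = ⊥-elim (<⇒≱ (subst (ρ P y <_) (sym Px≡) (m<m+n (ρ P y) 0<d)) Px≤Py)
  ... | no Px≰Py | inj₁ Py≡ = ⊥-elim (Px≰Py (subst (ρ P x ≤_) (sym Py≡) (m≤m+n (ρ P x) (ρ x y))))
  ... | no _ | inj₂ Px≡ = trans Px≡ (cong (ρ P y +_) (ρ-sym x y))

  SameEnds-ρ : ∀ {p q x y} → SameEnds (p , q) x y → ρ p q ≡ ρ x y
  SameEnds-ρ (inj₁ (refl , refl)) = refl
  SameEnds-ρ {x = x} {y} (inj₂ (refl , refl)) = ρ-sym y x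

  SameEnds-Collinear : ∀ {p q x y c} → SameEnds (p , q) x y → Collinear p q c → Collinear x y c
  SameEnds-Collinear (inj₁ (refl , refl)) = λ col → col
  SameEnds-Collinear (inj₂ (refl , refl)) = Collinear-sym

  SameEnds-Collinear⁻ : ∀ {p q x y c} → SameEnds (p , q) x y → Collinear x y c → Collinear p q c
  SameEnds-Collinear⁻ (inj₁ (refl , refl)) = λ col → col
  SameEnds-Collinear⁻ (inj₂ (refl , refl)) = Collinear-sym

  SameEnds-unique : ∀ {p q x y x′ y′} → SameEnds (p , q) x y → SameEnds (p , q) x′ y′ →
    (x ≡ x′ × y ≡ y′) ⊎ (x ≡ y′ × y ≡ x′)
  SameEnds-unique (inj₁ (refl , refl)) (inj₁ (refl , refl)) = inj₁ (refl , refl)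
  SameEnds-unique (inj₁ (refl , refl)) (inj₂ (refl , refl)) = inj₂ (refl , refl)
  SameEnds-unique (inj₂ (refl , refl)) (inj₁ (refl , refl)) = inj₂ (refl , refl)
  SameEnds-unique (inj₂ (refl , refl)) (inj₂ (refl , refl)) = inj₁ (refl , refl)

  SameEnds-Inside⇒< : ∀ {p q x y P} → SameEnds (p , q) x y → Inside P x y → ρ q P < ρ x y
  SameEnds-Inside⇒< {p} {q} (inj₁ (refl , refl)) inside = subst (ρ q _ <_) (ρ-sym q p) (Inside⇒< (Inside-sym inside))
  SameEnds-Inside⇒< (inj₂ (refl , refl)) inside = Inside⇒< inside

module Configuration {n : ℕ} (G : Graph n) (ρ : Fin n → Fin n → ℕ) (isMetric : IsGraphMetric G ρ)
  {ℓ : ℕ} (2≤ℓ : 2 ≤ ℓ) {Q : ℕ} (a b : Fin Q → Fin n) (ρ-ab : ∀ i → ρ (a i) (b i) ≡ ℓ)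
  (sameLine : ∀ {i j} → i ≢ j → Metric.line ρ (a i) (b i) ≡ Metric.line ρ (a j) (b j))
  (distinct : ∀ {i j} → i ≢ j → Metric.DistinctPairs ρ (a i) (b i) (a j) (b j))
  (geodesic : ∀ {i j} → i ≢ j → Metric.GeodesicSet ρ (a i ∷ b i ∷ a j ∷ b j ∷ [])) where

  open GraphMetric G ρ isMetric
  open Collinearity ρ

  near far : Fin n → Fin Q → Fin n
  near P i = proj₁ (orient P (a i) (b i))
  far P i = proj₂ (orient P (a i) (b i))

  ends : ∀ P i → SameEnds (near P i , far P i) (a i) (b i)
  ends P i = orient-ends P (a i) (b i)

  ρ-near-far : ∀ P i → ρ (near P i) (far P i) ≡ ℓ
  ρ-near-far P i = trans (SameEnds-ρ (ends P i)) (ρ-ab i)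

  OutsideOf : Fin n → Fin Q → Set
  OutsideOf P i = Outside P (a i) (b i)

  OutsideOf? : ∀ P i → Dec (OutsideOf P i)
  OutsideOf? P i = (ρ P (b i) ≟ ρ P (a i) + ρ (a i) (b i)) ⊎-dec (ρ P (a i) ≟ ρ P (b i) + ρ (a i) (b i))

  OutsideOf-end : ∀ i → OutsideOf (a i) i
  OutsideOf-end i = inj₁ (cong (_+ ρ (a i) (b i)) (sym (ρ-refl (a i))))

  beyond : ∀ {P i} → OutsideOf P i → Between P (near P i) (far P i)
  beyond {i = i} = orient-beyond (subst (0 <_) (sym (ρ-ab i)) (≤-trans (s≤s z≤n) 2≤ℓ))

  Collinear-near-far : ∀ {P j k c} → j ≢ k → Collinear (near P j) (far P j) c → Collinear (near P k) (far P k) c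
  Collinear-near-far {P} {j} {k} j≢k =
    SameEnds-Collinear⁻ (ends P k) ∘ line-≡⇒Collinear (sameLine j≢k) ∘ SameEnds-Collinear (ends P j)

  Endpoints : Fin Q → Fin Q → List (Fin n)
  Endpoints j k = a j ∷ b j ∷ a k ∷ b k ∷ []

  ∈Endpointsˡ : ∀ {p q j k} → SameEnds (p , q) (a j) (b j) → p ∈ Endpoints j k × q ∈ Endpoints j k
  ∈Endpointsˡ (inj₁ (refl , refl)) = here refl , there (here refl)
  ∈Endpointsˡ (inj₂ (refl , refl)) = there (here refl) , here refl

  ∈Endpointsʳ : ∀ {p q j k} → SameEnds (p , q) (a k) (b k) → p ∈ Endpoints j k × q ∈ Endpoints j k
  ∈Endpointsʳ (inj₁ (refl , refl)) = there (there (here refl)) , there (there (there (here refl)))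
  ∈Endpointsʳ (inj₂ (refl , refl)) = there (there (there (here refl))) , there (there (here refl))

  far-ends-apart : ∀ {P j k} → j ≢ k → OutsideOf P j → OutsideOf P k → ρ P (far P j) ≡ ρ P (far P k) →
    ρ (far P j) (far P k) ≡ ρ (near P j) (near P k) + ℓ + ℓ
  far-ends-apart {P} {j} {k} j≢k out-j out-k equidistant with near P j Fin.≟ near P k
  ... | no nⱼ≢nₖ = far-ends-apart-distinct 2≤ℓ (ρ-near-far P j) (ρ-near-far P k) (beyond out-j) (beyond out-k)
                     equidistant (Collinear-near-far j≢k) (Collinear-near-far (j≢k ∘ sym)) nⱼ≢nₖ
  ... | yes nⱼ≡nₖ = begin
      ρ (far P j) (far P k)                   ≡⟨ far-ends-apart-common ruler (proj₁ (∈Endpointsˡ (ends P j)))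
                                                   (proj₂ (∈Endpointsˡ (ends P j))) (proj₂ (∈Endpointsʳ (ends P k)))
                                                   (ρ-near-far P j) ρ-nⱼ-fₖ fⱼ≢fₖ ⟩
      ℓ + ℓ                                   ≡⟨ cong (λ d → d + ℓ + ℓ) (sym ρ-nⱼ-nₖ) ⟩
      ρ (near P j) (near P k) + ℓ + ℓ         ∎
    where
    open ≡-Reasoning
    ruler = proj₂ (GeodesicSet⇒IsRuler (geodesic j≢k))
    ρ-nⱼ-fₖ : ρ (near P j) (far P k) ≡ ℓ
    ρ-nⱼ-fₖ = subst (λ p → ρ p (far P k) ≡ ℓ) (sym nⱼ≡nₖ) (ρ-near-far P k)
    ρ-nⱼ-nₖ : ρ (near P j) (near P k) ≡ 0
    ρ-nⱼ-nₖ = subst (λ p → ρ (near P j) p ≡ 0) nⱼ≡nₖ (ρ-refl (near P j))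
    fⱼ≢fₖ : far P j ≢ far P k
    fⱼ≢fₖ fⱼ≡fₖ = distinct j≢k (SameEnds-unique (ends P j)
      (subst₂ (λ p q → SameEnds (p , q) (a k) (b k)) (sym nⱼ≡nₖ) (sym fⱼ≡fₖ) (ends P k)))

  ¬OutsideOf-end⇒OutsideOf-other-end : ∀ {i j} → i ≢ j → ¬ OutsideOf (a i) j → OutsideOf (b i) j
  ¬OutsideOf-end⇒OutsideOf-other-end {i} {j} i≢j ¬out-a with OutsideOf? (b i) j
  ... | yes out-b = out-b
  ... | no ¬out-b = ⊥-elim (¬Inside×Inside (proj₂ (GeodesicSet⇒IsRuler (geodesic i≢j)))
          (here refl) (there (here refl)) (there (there (here refl))) (there (there (there (here refl))))
          (trans (ρ-ab i) (sym (ρ-ab j)))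
          (¬Outside⇒Inside (line-≡⇒Collinear (sameLine i≢j) (at-x refl)) ¬out-a)
          (¬Outside⇒Inside (line-≡⇒Collinear (sameLine i≢j) (at-y refl)) ¬out-b))

  module FromBase (z : Fin Q) (D : ℕ) (diameter : ∀ u v → ρ u v ≤ D) where
    open Counting

    A B : Fin n
    A = a z
    B = b z

    reach : Fin n → Fin Q → ℕ
    reach P i = ρ P (far P i)

    reach-InRange : ∀ {P i} → OutsideOf P i → InRange (reach P) D i
    reach-InRange {P} {i} out = ≤-trans (≤-trans (s≤s z≤n) 2≤ℓ) ℓ≤reach , diameter P (far P i)
      where
      ℓ≤reach : ℓ ≤ reach P i
      ℓ≤reach = subst (ℓ ≤_) (sym (trans (beyond out) (cong (ρ P (near P i) +_) (ρ-near-far P i))))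
                  (m≤n+m ℓ (ρ P (near P i)))

    base≢ : ∀ {j} → ¬ OutsideOf A j → z ≢ j
    base≢ ¬out refl = ¬out (OutsideOf-end z)

    outside-B : ∀ {j} → ¬ OutsideOf A j → OutsideOf B j
    outside-B ¬out = ¬OutsideOf-end⇒OutsideOf-other-end (base≢ ¬out) ¬out

    reach-B-≢ : ∀ {j k} → j ≢ k → ¬ OutsideOf A j → ¬ OutsideOf A k → reach B j ≢ reach B k
    reach-B-≢ {j} {k} j≢k ¬out-j ¬out-k equidistant = <⇒≱ (begin-strict
      ρ (far B j) (far B k)            ≤⟨ ρ-triangle (far B j) A (far B k) ⟩
      ρ (far B j) A + ρ A (far B k)    <⟨ +-mono-< (close ¬out-j) (subst (_< ℓ) (ρ-sym (far B k) A) (close ¬out-k)) ⟩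
      ℓ + ℓ                            ≤⟨ m≤n+m (ℓ + ℓ) (ρ (near B j) (near B k)) ⟩
      ρ (near B j) (near B k) + (ℓ + ℓ) ≡⟨ sym (+-assoc _ ℓ ℓ) ⟩
      ρ (near B j) (near B k) + ℓ + ℓ  ∎)
      (≤-reflexive (sym (far-ends-apart j≢k (outside-B ¬out-j) (outside-B ¬out-k) equidistant)))
      where
      open ≤-Reasoning
      close : ∀ {i} → ¬ OutsideOf A i → ρ (far B i) A < ℓ
      close {i} ¬out = subst (ρ (far B i) A <_) (ρ-ab i)
        (SameEnds-Inside⇒< (ends B i) (¬Outside⇒Inside (line-≡⇒Collinear (sameLine (base≢ ¬out)) (at-x refl)) ¬out))

    outsideA insideA : List (Fin Q)
    outsideA = filter (OutsideOf? A) (allFin Q)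
    insideA = filter (∁? (OutsideOf? A)) (allFin Q)

    length-insideA≤D : length insideA ≤ D
    length-insideA≤D = length≤-InjectiveOn (reach B) D (Unique.filter⁺ _ (Unique.allFin⁺ Q))
      (All.map (reach-InRange ∘ outside-B) inside) injective
      where
      inside : All (¬_ ∘ OutsideOf A) insideA
      inside = all-filter (∁? (OutsideOf? A)) (allFin Q)
      injective : InjectiveOn (reach B) insideA
      injective j∈ k∈ equidistant = decidable-stable (_ Fin.≟ _) λ j≢k →
        reach-B-≢ j≢k (All.lookup inside j∈) (All.lookup inside k∈) equidistant

    largest : ∃ λ v → length outsideA ≤ D * length (fibre (reach A) v outsideA)
    largest = large-fibre (reach A) D outsideA (All.map reach-InRange (all-filter (OutsideOf? A) (allFin Q)))

    F : List (Fin Q)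
    F = fibre (reach A) (proj₁ largest) outsideA

    Q≤D*F+D : Q ≤ D * length F + D
    Q≤D*F+D = begin
      Q                                   ≡⟨ sym (length-tabulate {n = Q} (λ i → i)) ⟩
      length (allFin Q)                   ≡⟨ sym (length-filter-∁ (OutsideOf? A) (allFin Q)) ⟩
      length outsideA + length insideA    ≤⟨ +-mono-≤ (proj₂ largest) length-insideA≤D ⟩
      D * length F + D                    ∎
      where open ≤-Reasoning

    far-apart : ∀ {j k} → j ∈ F → k ∈ F → j ≢ k → ρ (far A j) (far A k) ≡ ρ (near A j) (near A k) + ℓ + ℓ
    far-apart j∈ k∈ j≢k = far-ends-apart j≢k (All.lookup outside j∈) (All.lookup outside k∈)
      (trans (All.lookup equidistant j∈) (sym (All.lookup equidistant k∈)))
      where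
      outside : All (OutsideOf A) F
      outside = filter⁺ _ (all-filter (OutsideOf? A) (allFin Q))
      equidistant : All (λ j → reach A j ≡ proj₁ largest) F
      equidistant = all-filter _ outsideA

    far-≢ : ∀ {j k} → j ∈ F → k ∈ F → j ≢ k → far A j ≢ far A k
    far-≢ {j} {k} j∈ k∈ j≢k fⱼ≡fₖ =
      <⇒≱ 2≤ℓ (≤-trans (≤-reflexive (m+n≡0⇒n≡0 (ρ (near A j) (near A k) + ℓ)
        (trans (sym (far-apart j∈ k∈ j≢k)) (subst (λ q → ρ (far A j) q ≡ 0) fⱼ≡fₖ (ρ-refl (far A j)))))) z≤n)

    farPoints : List (Fin n)
    farPoints = map (far A) F

    Unique-farPoints : Unique farPoints
    Unique-farPoints = Unique-map⁺ (Unique.filter⁺ _ (Unique.filter⁺ _ (Unique.allFin⁺ Q)))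
      λ j∈ k∈ fⱼ≡fₖ → decidable-stable (_ Fin.≟ _) λ j≢k → far-≢ j∈ k∈ j≢k fⱼ≡fₖ

    GeneralPosition-farPoints : GeneralPosition farPoints
    GeneralPosition-farPoints p∈ q∈ r∈ p≢q r≢p r≢q r∈line
      with ∈-map⁻ (far A) p∈ | ∈-map⁻ (far A) q∈ | ∈-map⁻ (far A) r∈
    ... | j , j∈ , refl | k , k∈ , refl | m , m∈ , refl = collinear (Equivalence.from Collinear⇔∈line r∈line)
      where
      apart : ∀ {j k} → j ∈ F → k ∈ F → far A j ≢ far A k →
        ρ (far A j) (far A k) ≡ ρ (near A j) (near A k) + ℓ + ℓ
      apart j∈ k∈ fⱼ≢fₖ = far-apart j∈ k∈ (λ { refl → fⱼ≢fₖ refl })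
      ¬between : ∀ {j k m} → j ∈ F → k ∈ F → m ∈ F →
        far A j ≢ far A k → far A k ≢ far A m → far A j ≢ far A m → ¬ Between (far A j) (far A k) (far A m)
      ¬between j∈ k∈ m∈ fⱼ≢fₖ fₖ≢fₘ fⱼ≢fₘ =
        ¬Between-far-ends (≤-trans (s≤s z≤n) 2≤ℓ) (apart j∈ k∈ fⱼ≢fₖ) (apart k∈ m∈ fₖ≢fₘ) (apart j∈ m∈ fⱼ≢fₘ)
      collinear : ¬ Collinear (far A j) (far A k) (far A m)
      collinear (at-x e) = r≢p e
      collinear (at-y e) = r≢q e
      collinear (x-y-c jkm) = ¬between j∈ k∈ m∈ p≢q (r≢q ∘ sym) (r≢p ∘ sym) jkm
      collinear (y-c-x kmj) = ¬between k∈ m∈ j∈ (r≢q ∘ sym) r≢p (p≢q ∘ sym) kmj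
      collinear (c-x-y mjk) = ¬between m∈ j∈ k∈ r≢p p≢q r≢q mjk

    numLines-≥-farPoints : length F * (length F ∸ 1) ≤ 2 * Metric.numLines ρ
    numLines-≥-farPoints = subst (λ L → L * (L ∸ 1) ≤ 2 * Metric.numLines ρ) (length-map (far A) F)
      (numLines-≥ Unique-farPoints GeneralPosition-farPoints)

module Arithmetic where

  square-bound : ∀ k s → 2 * k + 4 ≤ s → k * ((s + 2) * (s + 2)) ≤ (k + 2) * (suc s * s)
  square-bound k s 2k+4≤s = subst (λ s → k * ((s + 2) * (s + 2)) ≤ (k + 2) * (suc s * s)) (m+[n∸m]≡n 2k+4≤s)
    (≤-trans (m≤m+n _ _) (≤-reflexive (sym (expand k (s ∸ (2 * k + 4))))))
    where
    expand : ∀ k r → (k + 2) * (suc (2 * k + 4 + r) * (2 * k + 4 + r)) ≡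
      k * ((2 * k + 4 + r + 2) * (2 * k + 4 + r + 2)) + (2 * k * k + 20 * k + 40 + 5 * k * r + 18 * r + 2 * r * r)
    expand = solve-∀

  ≤-cancel-D : ∀ {K D M Q} .{{_ : ℕ.NonZero D}} → K * D ≤ Q → Q ≤ D * M + D → K ≤ M + 1
  ≤-cancel-D {K} {D} {M} KD≤Q Q≤DM+D =
    *-cancelʳ-≤ K (M + 1) D (≤-trans KD≤Q (≤-trans Q≤DM+D (≤-reflexive (regroup D M))))
    where
    regroup : ∀ D M → D * M + D ≡ (M + 1) * D
    regroup = solve-∀

  -- K = 2m + 2 forces M ≥ 2m + 1, which is what (m − 2)(M + 1)² ≤ m M (M − 1) needs.
  lines-bound : ∀ m D M Q L → (2 * m + 2) * D ≤ Q → Q ≤ D * M + D → M * (M ∸ 1) ≤ 2 * L →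
    (m ∸ 2) * (Q * Q) ≤ 2 * m * (D * D) * L
  lines-bound 0 _ _ _ _ _ _ _ = z≤n
  lines-bound 1 _ _ _ _ _ _ _ = z≤n
  lines-bound (suc (suc k)) 0 M .0 L _ z≤n _ = ≤-trans (≤-reflexive (*-zeroʳ k)) z≤n
  lines-bound (suc (suc k)) D@(suc _) 0 Q L KD≤Q Q≤DM+D _ =
    ⊥-elim (<⇒≱ (s≤s (s≤s z≤n)) (≤-trans (m≤n+m 2 (2 * suc (suc k))) (≤-cancel-D KD≤Q Q≤DM+D)))
  lines-bound (suc (suc k)) D@(suc _) (suc s) Q L KD≤Q Q≤DM+D M*M-1≤2L = begin
    k * (Q * Q)                              ≤⟨ *-monoʳ-≤ k (*-mono-≤ Q≤D[s+2] Q≤D[s+2]) ⟩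
    k * ((D * (s + 2)) * (D * (s + 2)))      ≡⟨ regroup₁ k D (s + 2) ⟩
    D * D * (k * ((s + 2) * (s + 2)))        ≤⟨ *-monoʳ-≤ (D * D) (square-bound k s 2k+4≤s) ⟩
    D * D * ((k + 2) * (suc s * s))          ≤⟨ *-monoʳ-≤ (D * D) (*-monoʳ-≤ (k + 2) M*M-1≤2L) ⟩
    D * D * ((k + 2) * (2 * L))              ≡⟨ regroup₂ k D L ⟩
    2 * suc (suc k) * (D * D) * L            ∎
    where
    open ≤-Reasoning
    Q≤D[s+2] : Q ≤ D * (s + 2)
    Q≤D[s+2] = ≤-trans Q≤DM+D (≤-reflexive (regroup D s))
      where
      regroup : ∀ D s → D * suc s + D ≡ D * (s + 2)
      regroup = solve-∀
    2k+4≤s : 2 * k + 4 ≤ s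
    2k+4≤s = +-cancelʳ-≤ 2 _ _ (≤-trans (≤-reflexive (regroup k)) (≤-trans K≤M+1 (≤-reflexive (sym (+-suc s 1)))))
      where
      regroup : ∀ k → 2 * k + 4 + 2 ≡ 2 * suc (suc k) + 2
      regroup = solve-∀
      K≤M+1 : 2 * suc (suc k) + 2 ≤ suc s + 1
      K≤M+1 = ≤-cancel-D {M = suc s} KD≤Q Q≤DM+D
    regroup₁ : ∀ k D t → k * ((D * t) * (D * t)) ≡ D * D * (k * (t * t))
    regroup₁ = solve-∀
    regroup₂ : ∀ k D L → D * D * ((k + 2) * (2 * L)) ≡ 2 * suc (suc k) * (D * D) * L
    regroup₂ = solve-∀

mainTheorem17 : (m : ℕ) → 0 < m →
    ∃ λ (K : ℕ) →
    ∀ (n : ℕ) (G : Graph n) (ρ : Fin n → Fin n → ℕ) (D : ℕ) →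
    IsGraphMetric G ρ → IsDiameter ρ D →
    ∀ (Q ℓ : ℕ) → 0 < Q → 2 ≤ ℓ →
    (a b : Fin Q → Fin n) →
    (∀ i → ρ (a i) (b i) ≡ ℓ) →
    (∀ i j → i ≢ j →
    Metric.line ρ (a i) (b i) ≡ Metric.line ρ (a j) (b j) ×
    Metric.αRelated ρ (a i) (b i) (a j) (b j) ×
    ρ (a i) (b i) ≡ ℓ × ρ (a j) (b j) ≡ ℓ) →
    K * D ≤ Q →
    (m ∸ 2) * (Q * Q) ≤ 2 * m * (D * D) * Metric.numLines ρ
mainTheorem17 m _ = 2 * m + 2 , λ where
  n G ρ D isMetric (diameter , _) (suc Q) ℓ _ 2≤ℓ a b ρ-ab related KD≤Q →
    let open Configuration G ρ isMetric 2≤ℓ a b ρ-ab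
               (λ i≢j → proj₁ (related _ _ i≢j))
               (λ i≢j → let _ , (_ , _ , distinct , _ , _) , _ = related _ _ i≢j in distinct)
               (λ i≢j → let _ , (_ , _ , _ , _ , geodesic) , _ = related _ _ i≢j in geodesic)
        open FromBase Fin.zero D diameter
    in Arithmetic.lines-bound m D (length F) (suc Q) (Metric.numLines ρ) KD≤Q Q≤D*F+D numLines-≥-farPoints
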